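{- Let $(B,\mathcal{S})$ be an instance of the 3-partition problem with $\mathcal{S}=(k_1,\dots,k_{3m})$, and let $A_{B,\mathcal{S}}$ be the symbolic heap $$\bigwedge_{i=1}^{m}(d_{i+1}=d_i+B+1)\wedge\bigwedge_{j=1}^{3m}(d_1\le a_j)\wedge(a_j+k_j<d_{m+1}) \;:\; \mathop{*}_{i=1}^{m+1}\mathsf{array}(d_i,0,0) * \mathop{*}_{j=1}^{3m}\mathsf{array}(a_j,1,k_j),$$ where $d_1,\dots,d_{m+1},a_1,\dots,a_{3m}$ are distinct variables. Then $A_{B,\mathcal{S}}$ is satisfiable if and only if $\mathcal{S}$ admits a complete 3-partition with respect to $B$.
   Context: Array separation logic (ASL). Terms: $t ::= x \mid n \mid t+t \mid n\,t$ ($x$ a variable, $n\in\mathbb{N}$). Pure formulas: finite conjunctions of $t=t$, $t\neq t$, $t\le t$, $t<t$. Spatial formulas: $F ::= \mathsf{emp} \mid t\mapsto t \mid \mathsf{array}(t,t) \mid F * F$. A quantifier-free symbolic heap is $\Pi:F$. Stacks $s:\mathsf{Var}\to\mathbb{N}$; heaps finite partial functions $\mathbb{N}\rightharpoonup\mathbb{N}$; $h_1\circ h_2$ is the union of domain-disjoint heaps. $s,h\models\mathsf{array}(t_1,t_2)$ iff $s(t_1)\le s(t_2)$ and $\mathrm{dom}(h)=\{s(t_1),\dots,s(t_2)\}$; $s,h\models t_1\mapsto t_2$ iff $\mathrm{dom}(h)=\{s(t_1)\}$ and $h(s(t_1))=s(t_2)$; $s,h\models\mathsf{emp}$ iff $h$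 is empty; $s,h\models F_1*F_2$ iff $h=h_1\circ h_2$ with $s,h_i\models F_i$; pure atoms are evaluated arithmetically. A symbolic heap is satisfiable if some $(s,h)$ satisfies it. Base-offset notation: $\mathsf{array}(b,i,j)$ abbreviates $\mathsf{array}(b+i,b+j)$. 3-partition problem: an instance is a bound $B\in\mathbb{N}$ and a sequence $\mathcal{S}=(k_1,\dots,k_{3m})$ of naturals with $\sum_{j=1}^{3m}k_j=mB$ and $B/4<k_j<B/2$ for all $j$; a complete 3-partition is a partition of the elements of $\mathcal{S}$ into $m$ groups of three, each group summing to $B$. -}

module Defs where

open import Data.Nat using (ℕ; zero; suc; _+_; _*_; _≤_; _<_)
open import Data.Fin using (Fin; toℕ)
open import Data.Maybe using (Maybe; just; nothing)
open import Data.List using (List; []; _∷_; _++_; foldr; tabulate)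
import Data.Vec as Vec
open import Data.Product using (Σ; ∃; _×_; _,_)
open import Data.Sum using (_⊎_)
open import Data.Unit using (⊤)
open import Data.Empty using (⊥)
open import Relation.Nullary using (¬_)
open import Relation.Binary.PropositionalEquality using (_≡_; _≢_)
open import Function.Bundles using (_↔_; Inverse)

-- Variables: two disjoint families, so the d's and a's are automatically
-- pairwise distinct.  dv i stands for d_{i+1}, av j for a_{j+1}.
data Var : Set where
  dv : ℕ → Var
  av : ℕ → Var

data Term : Set where
  var  : Var → Term
  num  : ℕ → Term
  _⊕_  : Term → Term → Term
  _⊛_  : ℕ → Term → Term

infixl 6 _⊕_
infixr 7 _⊛_

data PureAtom : Set where
  _=ₜ_ _≠ₜ_ _≤ₜ_ _<ₜ_ : Term → Term → PureAtom

Pure : Set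
Pure = List PureAtom

data Spatial : Set where
  emp   : Spatial
  _↦_   : Term → Term → Spatial
  array : Term → Term → Spatial
  _⋆_   : Spatial → Spatial → Spatial

infixr 5 _⋆_

record SymHeap : Set where
  constructor _∶_
  field
    pure    : Pure
    spatial : Spatial

Stack : Set
Stack = Var → ℕ

record Heap : Set where
  field
    at     : ℕ → Maybe ℕ
    finite : ∃ λ N → ∀ n → N ≤ n → at n ≡ nothing
open Heap public

_∈dom_ : ℕ → Heap → Set
n ∈dom h = at h n ≢ nothing

⟦_⟧ : Term → Stack → ℕ
⟦ var x ⟧ s = s x
⟦ num n ⟧ s = n
⟦ t ⊕ u ⟧ s = ⟦ t ⟧ s + ⟦ u ⟧ s
⟦ n ⊛ t ⟧ s = n * ⟦ t ⟧ s

_⊨ᵃ_ : Stack → PureAtom → Set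
s ⊨ᵃ (t =ₜ u) = ⟦ t ⟧ s ≡ ⟦ u ⟧ s
s ⊨ᵃ (t ≠ₜ u) = ⟦ t ⟧ s ≢ ⟦ u ⟧ s
s ⊨ᵃ (t ≤ₜ u) = ⟦ t ⟧ s ≤ ⟦ u ⟧ s
s ⊨ᵃ (t <ₜ u) = ⟦ t ⟧ s < ⟦ u ⟧ s

_⊨ᵖ_ : Stack → Pure → Set
s ⊨ᵖ [] = ⊤
s ⊨ᵖ (a ∷ as) = (s ⊨ᵃ a) × (s ⊨ᵖ as)

_≣_∘_ : Heap → Heap → Heap → Set
h ≣ h₁ ∘ h₂ = ∀ n →
  (at h₁ n ≡ nothing × at h n ≡ at h₂ n) ⊎ (at h₂ n ≡ nothing × at h n ≡ at h₁ n)

_,_⊨ˢ_ : Stack → Heap → Spatial → Set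
s , h ⊨ˢ emp = ∀ n → at h n ≡ nothing
s , h ⊨ˢ (t ↦ u) = ∀ n → (n ≡ ⟦ t ⟧ s → at h n ≡ just (⟦ u ⟧ s))
                        × (n ≢ ⟦ t ⟧ s → at h n ≡ nothing)
s , h ⊨ˢ array t u = (⟦ t ⟧ s ≤ ⟦ u ⟧ s)
                    × (∀ n → (n ∈dom h → ⟦ t ⟧ s ≤ n × n ≤ ⟦ u ⟧ s)
                           × (⟦ t ⟧ s ≤ n × n ≤ ⟦ u ⟧ s → n ∈dom h))
s , h ⊨ˢ (F ⋆ G) = Σ Heap λ h₁ → Σ Heap λ h₂ →
                    (h ≣ h₁ ∘ h₂) × (s , h₁ ⊨ˢ F) × (s , h₂ ⊨ˢ G)

_,_⊨_ : Stack → Heap → SymHeap → Set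
s , h ⊨ (Π ∶ F) = (s ⊨ᵖ Π) × (s , h ⊨ˢ F)

Satisfiable : SymHeap → Set
Satisfiable A = Σ Stack λ s → Σ Heap λ h → s , h ⊨ A

⋆-big : List Spatial → Spatial
⋆-big = foldr _⋆_ emp

arrayBO : Term → ℕ → ℕ → Spatial
arrayBO b i j = array (b ⊕ num i) (b ⊕ num j)

sumFin : ∀ {n} → (Fin n → ℕ) → ℕ
sumFin k = Vec.sum (Vec.tabulate k)

-- (B, S) with S = (k₁,…,k_{3m}) is an instance of 3-partition:
-- Σ k_j = m B and B/4 < k_j < B/2 (i.e. B < 4 k_j and 2 k_j < B).
Is3PartitionInstance : (B m : ℕ) → (Fin (3 * m) → ℕ) → Set
Is3PartitionInstance B m k =
  (sumFin k ≡ m * B) × (∀ j → B < 4 * k j × 2 * k j < B)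

-- A complete 3-partition: the index set {1..3m} is partitioned into m
-- groups of three (a bijection Fin m × Fin 3 ↔ Fin (3m)), each summing to B.
Complete3Partition : (B m : ℕ) → (Fin (3 * m) → ℕ) → Set
Complete3Partition B m k =
  Σ ((Fin m × Fin 3) ↔ Fin (3 * m)) λ σ →
    ∀ i → sumFin (λ (r : Fin 3) → k (Inverse.to σ (i , r))) ≡ B

d : ℕ → Term
d i = var (dv i)

a : ℕ → Term
a j = var (av j)

A[_,_,_] : (B m : ℕ) → (Fin (3 * m) → ℕ) → SymHeap
A[ B , m , k ] =
  (  tabulate {n = m} (λ i → d (suc (toℕ i)) =ₜ (d (toℕ i) ⊕ num B ⊕ num 1))
  ++ tabulate {n = 3 * m} (λ j → d 0 ≤ₜ a (toℕ j))
  ++ tabulate {n = 3 * m} (λ j → (a (toℕ j) ⊕ num (k j)) <ₜ d m) )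
  ∶
  (⋆-big (tabulate {n = suc m} (λ i → arrayBO (d (toℕ i)) 0 0))
   ⋆ ⋆-big (tabulate {n = 3 * m} (λ j → arrayBO (a (toℕ j)) 1 (k j))))

-- In a model of A, the constraints on d put d₁, …, d_{m+1} on the grid D + i(B+1), and every
-- block a_j + 1, …, a_j + k_j must avoid these points, so it lies in one of the m cells of B free
-- addresses between consecutive grid points. Disjointness caps the total length of the blocks in a
-- cell at B; as all lengths add up to mB, every cell is filled exactly. Since each k_j exceeds B/4,
-- a cell holds at most three blocks, hence, with 3m blocks in m cells, exactly three: the cells
-- form a complete 3-partition. Conversely, a 3-partition is realised by laying out group i
-- consecutively in cell i.
--
-- Separation is handled by counting: cov F s x is the number of atoms of F covering the address x.
-- It is at most 1 in every model, and for array-only formulas this bound also produces a model.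

module Submission where

open import Defs
open import Data.Nat
open import Data.Nat.Properties
open import Data.Nat.DivMod using (_/_; _%_; m/n*n≤m; m%n<n; m≡m%n+[m/n]*n; m<n*o⇒m/o<n)
open import Data.Nat.Tactic.RingSolver using (solve-∀)
open import Data.Fin as Fin using (Fin; zero; suc; toℕ; fromℕ<)
import Data.Fin.Properties as Finₚ
open import Data.Bool.Base using (if_then_else_)
open import Data.Maybe using (Maybe; just; nothing)
open import Data.List using ([]; _∷_; _++_; tabulate)
open import Data.Product using (Σ; ∃; _×_; _,_; proj₁; proj₂)
open import Data.Product.Algebra using (×-comm)
open import Data.Sum using (_⊎_; inj₁; inj₂)
open import Data.Unit using (⊤; tt)
open import Data.Empty using (⊥)
open import Function.Base using (_∘_)
open import Function.Bundles using (_⇔_; mk⇔; _↔_; Inverse; mk↔ₛ′)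
open import Function.Definitions using (Injective; StrictlySurjective)
open import Function.Properties.Inverse using (↔-sym; ↔-trans)
open import Relation.Nullary using (Dec; does; yes; no; ¬_; contradiction)
open import Relation.Nullary.Decidable using (_×-dec_)
open import Relation.Binary.Definitions using (tri<; tri≈; tri>)
open import Relation.Binary.PropositionalEquality
open import Algebra.Properties.Semiring.Sum +-*-semiring
  using ( sum; sum-syntax; sum-cong-≗; sum-remove; ∑-distrib-+; ∑-comm
        ; *-distribˡ-sum; *-distribʳ-sum)

-- Defined through `does`, not by matching on yes/no, so that 𝟙 (suc i ≟ suc j) computes to
-- 𝟙 (i ≟ j).
𝟙 : ∀ {p} {P : Set p} → Dec P → ℕ
𝟙 P? = if does P? then 1 else 0

module _ {p} {P : Set p} where

  𝟙-yes : (P? : Dec P) → P → 𝟙 P? ≡ 1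
  𝟙-yes (yes _) _  = refl
  𝟙-yes (no ¬p) p = contradiction p ¬p

  𝟙-no : (P? : Dec P) → ¬ P → 𝟙 P? ≡ 0
  𝟙-no (yes p) ¬p = contradiction p ¬p
  𝟙-no (no _)  _  = refl

  𝟙-pos : (P? : Dec P) → 0 < 𝟙 P? → P
  𝟙-pos (yes p) _ = p

module _ {p q} {P : Set p} {Q : Set q} where

  𝟙-cong : (P? : Dec P) (Q? : Dec Q) → (P → Q) → (Q → P) → 𝟙 P? ≡ 𝟙 Q?
  𝟙-cong P? Q? P→Q Q→P with P?
  ... | yes p = sym (𝟙-yes Q? (P→Q p))
  ... | no ¬p = sym (𝟙-no Q? (¬p ∘ Q→P))

module _ {p q r} {P : Set p} {Q : Set q} {R : Set r} where

  𝟙-+-≤ : (P? : Dec P) (Q? : Dec Q) (R? : Dec R) →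
          (P → R) → (Q → R) → ¬ (P × Q) → 𝟙 P? + 𝟙 Q? ≤ 𝟙 R?
  𝟙-+-≤ P? Q? R? P→R Q→R ¬P×Q with P? | Q?
  ... | yes p | yes q = contradiction (p , q) ¬P×Q
  ... | yes p | no _  = ≤-reflexive (sym (𝟙-yes R? (P→R p)))
  ... | no _  | yes q = ≤-reflexive (sym (𝟙-yes R? (Q→R q)))
  ... | no _  | no _  = z≤n

sumFin≗sum : ∀ {n} (f : Fin n → ℕ) → sumFin f ≡ sum f
sumFin≗sum {zero}  f = refl
sumFin≗sum {suc n} f = cong (f zero +_) (sumFin≗sum (f ∘ suc))

sum-mono-≤ : ∀ {n} {f g : Fin n → ℕ} → (∀ i → f i ≤ g i) → sum f ≤ sum g
sum-mono-≤ {zero}  f≤g = z≤n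
sum-mono-≤ {suc n} f≤g = +-mono-≤ (f≤g zero) (sum-mono-≤ (f≤g ∘ suc))

sum-const : ∀ n c → sum {n} (λ _ → c) ≡ n * c
sum-const zero    c = refl
sum-const (suc n) c = cong (c +_) (sum-const n c)

sum-zero : ∀ {n} {f : Fin n → ℕ} → (∀ i → f i ≡ 0) → sum f ≡ 0
sum-zero {n} f≡0 = trans (sum-cong-≗ f≡0) (trans (sum-const n 0) (*-zeroʳ n))

term≤sum : ∀ {n} (f : Fin n → ℕ) i → f i ≤ sum f
term≤sum {suc n} f i = subst (f i ≤_) (sym (sum-remove {i = i} f)) (m≤m+n (f i) _)

sum-δ : ∀ {n} (f : Fin n → ℕ) i → sum (λ j → 𝟙 (j Fin.≟ i) * f j) ≡ f i
sum-δ {suc n} f zero    =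
  trans (cong₂ _+_ (+-identityʳ (f zero)) (sum-zero {n} λ _ → refl)) (+-identityʳ (f zero))
sum-δ {suc n} f (suc i) = sum-δ (f ∘ suc) i

sum-𝟙≟ : ∀ {n} (i : Fin n) → sum (λ j → 𝟙 (j Fin.≟ i)) ≡ 1
sum-𝟙≟ i = trans (sum-cong-≗ (λ j → sym (*-identityʳ (𝟙 (j Fin.≟ i))))) (sum-δ (λ _ → 1) i)

sum-𝟙-pos : ∀ {p n} {P : Fin n → Set p} (P? : ∀ i → Dec (P i)) →
            0 < sum (λ i → 𝟙 (P? i)) → ∃ P
sum-𝟙-pos {n = suc n} P? pos with P? zero
... | yes p = zero , p
... | no _  = let i , p = sum-𝟙-pos (P? ∘ suc) pos in suc i , p

sum-𝟙≤1 : ∀ {p n} {P : Fin n → Set p} (P? : ∀ i → Dec (P i)) →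
          (∀ {i j} → P i → P j → i ≡ j) → sum (λ i → 𝟙 (P? i)) ≤ 1
sum-𝟙≤1 {n = zero}  P? unique = z≤n
sum-𝟙≤1 {n = suc n} P? unique with P? zero
... | yes p = ≤-reflexive (cong suc (sum-zero λ i → 𝟙-no (P? (suc i)) λ q → 0≢suc (unique p q)))
  where
  0≢suc : ∀ {i : Fin n} → zero ≢ suc i
  0≢suc ()
... | no _  = sum-𝟙≤1 (P? ∘ suc) (λ p q → Finₚ.suc-injective (unique p q))

+-≤-≡⇒≡ˡ : ∀ {a b c d} → a ≤ c → b ≤ d → a + b ≡ c + d → a ≡ c
+-≤-≡⇒≡ˡ {a} {b} {c} {d} a≤c b≤d eq = ≤-antisym a≤c (+-cancelʳ-≤ d c a (begin
  c + d  ≡⟨ eq ⟨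
  a + b  ≤⟨ +-monoʳ-≤ a b≤d ⟩
  a + d  ∎))
  where open ≤-Reasoning

sum-≤-const⇒≡ : ∀ {n b} {f : Fin n → ℕ} → (∀ i → f i ≤ b) → sum f ≡ n * b → ∀ i → f i ≡ b
sum-≤-const⇒≡ {suc n} {b} {f} f≤b eq = λ where
    zero    → head≡b
    (suc i) → sum-≤-const⇒≡ (f≤b ∘ suc) tail≡n*b i
  where
  tail≤n*b : sum (f ∘ suc) ≤ n * b
  tail≤n*b = subst (_ ≤_) (sum-const n b) (sum-mono-≤ (f≤b ∘ suc))
  head≡b : f zero ≡ b
  head≡b = +-≤-≡⇒≡ˡ (f≤b zero) tail≤n*b eq
  tail≡n*b : sum (f ∘ suc) ≡ n * b
  tail≡n*b = +-cancelˡ-≡ b _ _ (trans (cong (_+ sum (f ∘ suc)) (sym head≡b)) eq)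

sum-range-+ : ∀ a b (f : ℕ → ℕ) →
              ∑[ t < a + b ] f (toℕ t) ≡ ∑[ t < a ] f (toℕ t) + ∑[ t < b ] f (a + toℕ t)
sum-range-+ zero    b f = refl
sum-range-+ (suc a) b f =
  trans (cong (f 0 +_) (sum-range-+ a b (f ∘ suc))) (sym (+-assoc (f 0) _ _))

infix 4 _∈[_,_] _∈?[_,_]

_∈[_,_] : ℕ → ℕ → ℕ → Set
x ∈[ l , r ] = l ≤ x × x ≤ r

_∈?[_,_] : ∀ x l r → Dec (x ∈[ l , r ])
x ∈?[ l , r ] = l ≤? x ×-dec x ≤? r

interval-count : ∀ {lo L a k} → lo ≤ a + 1 → a + k < lo + L →
                 k ≤ ∑[ t < L ] 𝟙 (lo + toℕ t ∈?[ a + 1 , a + k ])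
interval-count {lo} {L} {a} {k} lo≤a+1 a+k<lo+L = begin
  k                                                            ≡⟨ *-identityʳ k ⟨
  k * 1                                                        ≡⟨ sum-const k 1 ⟨
  ∑[ t < k ] 1                                                 ≡⟨ sum-cong-≗ covered ⟨
  ∑[ t < k ] f (o + toℕ t)                                     ≤⟨ m≤m+n _ _ ⟩
  ∑[ t < k ] f (o + toℕ t) + ∑[ t < rest ] f (o + (k + toℕ t)) ≡⟨ sum-range-+ k rest (f ∘ (o +_)) ⟨
  ∑[ t < k + rest ] f (o + toℕ t)                              ≤⟨ m≤n+m _ _ ⟩
  ∑[ t < o ] f (toℕ t) + ∑[ t < k + rest ] f (o + toℕ t)       ≡⟨ sum-range-+ o (k + rest) f ⟨
  ∑[ t < o + (k + rest) ] f (toℕ t)                            ≡⟨ cong (λ n → ∑[ t < n ] f (toℕ t)) L≡ ⟨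
  ∑[ t < L ] f (toℕ t)                                         ∎
  where
  open ≤-Reasoning
  f : ℕ → ℕ
  f t = 𝟙 (lo + t ∈?[ a + 1 , a + k ])
  o : ℕ
  o = a + 1 ∸ lo
  shift : ∀ t → lo + (o + t) ≡ a + 1 + t
  shift t = trans (sym (+-assoc lo o t)) (cong (_+ t) (m+[n∸m]≡n lo≤a+1))
  o+k≤L : o + k ≤ L
  o+k≤L = +-cancelˡ-≤ lo _ _
    (subst (_≤ lo + L) (sym (trans (shift k) (trans (+-assoc a 1 k) (+-suc a k)))) a+k<lo+L)
  rest : ℕ
  rest = L ∸ (o + k)
  L≡ : L ≡ o + (k + rest)
  L≡ = trans (sym (m+[n∸m]≡n o+k≤L)) (+-assoc o k rest)
  covered : ∀ (t : Fin k) → f (o + toℕ t) ≡ 1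
  covered t = 𝟙-yes (lo + (o + toℕ t) ∈?[ a + 1 , a + k ])
    (subst (_∈[ a + 1 , a + k ]) (sym (shift (toℕ t)))
      (m≤m+n (a + 1) (toℕ t) ,
       subst (_≤ a + k) (sym (+-assoc a 1 (toℕ t))) (+-monoʳ-≤ a (Finₚ.toℕ<n t))))

packing : ∀ {n p} (a k : Fin n → ℕ) {P : Fin n → Set p} (P? : ∀ j → Dec (P j)) {lo L} →
          (∀ x → ∑[ j < n ] 𝟙 (x ∈?[ a j + 1 , a j + k j ]) ≤ 1) →
          (∀ j → P j → lo ≤ a j + 1 × a j + k j < lo + L) →
          ∑[ j < n ] (𝟙 (P? j) * k j) ≤ L
packing {n} a k P? {lo} {L} disjoint inside = begin
  ∑[ j < n ] (𝟙 (P? j) * k j)    ≤⟨ sum-mono-≤ counted ⟩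
  ∑[ j < n ] ∑[ t < L ] hit t j  ≡⟨ ∑-comm {n} {L} (λ j t → hit t j) ⟩
  ∑[ t < L ] ∑[ j < n ] hit t j  ≤⟨ sum-mono-≤ {L} (λ t → disjoint (lo + toℕ t)) ⟩
  ∑[ t < L ] 1                   ≡⟨ sum-const L 1 ⟩
  L * 1                          ≡⟨ *-identityʳ L ⟩
  L                              ∎
  where
  open ≤-Reasoning
  hit : Fin L → Fin n → ℕ
  hit t j = 𝟙 (lo + toℕ t ∈?[ a j + 1 , a j + k j ])
  counted : ∀ j → 𝟙 (P? j) * k j ≤ ∑[ t < L ] hit t j
  counted j with P? j
  ... | yes p = subst (_≤ ∑[ t < L ] hit t j) (sym (+-identityʳ (k j)))
                      (interval-count (proj₁ (inside j p)) (proj₂ (inside j p)))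
  ... | no _  = z≤n

m<[1+m/n]*n : ∀ m n .{{_ : NonZero n}} → m < suc (m / n) * n
m<[1+m/n]*n m n = begin-strict
  m                  ≡⟨ m≡m%n+[m/n]*n m n ⟩
  m % n + m / n * n  <⟨ +-monoˡ-< (m / n * n) (m%n<n m n) ⟩
  n + m / n * n      ∎
  where open ≤-Reasoning

interval-in-cell : ∀ {D B m a k} → D ≤ a → a + k < D + m * suc B →
                   (∀ i → i ≤ m → ¬ (D + i * suc B ∈[ a + 1 , a + k ])) →
                   ∃ λ (q : Fin m) → D + toℕ q * suc B ≤ a × a + k < D + suc (toℕ q) * suc B
interval-in-cell {D} {B} {m} {a} {k} D≤a a+k<end avoids =
  fromℕ< q<m ,
  subst (λ q → D + q * suc B ≤ a × a + k < D + suc q * suc B) (sym (Finₚ.toℕ-fromℕ< q<m))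
        (start≤a , a+k<next)
  where
  y q : ℕ
  y = a ∸ D
  q = y / suc B
  D+y≡a : D + y ≡ a
  D+y≡a = m+[n∸m]≡n D≤a
  start≤a : D + q * suc B ≤ a
  start≤a = subst (D + q * suc B ≤_) D+y≡a (+-monoʳ-≤ D (m/n*n≤m y (suc B)))
  a<next : a < D + suc q * suc B
  a<next = subst (_< D + suc q * suc B) D+y≡a (+-monoʳ-< D (m<[1+m/n]*n y (suc B)))
  q<m : q < m
  q<m = m<n*o⇒m/o<n (+-cancelˡ-< D y _
          (subst (_< D + m * suc B) (sym D+y≡a) (≤-<-trans (m≤m+n a k) a+k<end)))
  a+k<next : a + k < D + suc q * suc B
  a+k<next with a + k <? D + suc q * suc B
  ... | yes a+k<next = a+k<next
  ... | no  a+k≮next = contradiction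
    (subst (_≤ D + suc q * suc B) (+-comm 1 a) a<next , ≮⇒≥ a+k≮next) (avoids (suc q) q<m)

cell-end<next-cell : ∀ {B i i′} → i < i′ → i * suc B + B < i′ * suc B
cell-end<next-cell {B} {i} {i′} i<i′ =
  subst (_≤ i′ * suc B) (cong suc (+-comm B (i * suc B))) (*-monoˡ-≤ (suc B) i<i′)

cell-unique : ∀ {B i i′ x} → x ∈[ i * suc B + 1 , i * suc B + B ] →
              x ∈[ i′ * suc B + 1 , i′ * suc B + B ] → i ≡ i′
cell-unique {B} {i} {i′} (_ , x≤end) (start′≤x , _) with <-cmp i i′
... | tri≈ _ i≡i′ _ = i≡i′
... | tri< i<i′ _ _ =
  contradiction (≤-trans (m≤m+n _ 1) start′≤x) (<⇒≱ (≤-<-trans x≤end (cell-end<next-cell i<i′)))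
cell-unique {B} {i} {i′} (start≤x , _) (_ , x≤end′) | tri> _ _ i′<i =
  contradiction (≤-trans (m≤m+n _ 1) start≤x) (<⇒≱ (≤-<-trans x≤end′ (cell-end<next-cell i′<i)))

node∉cell : ∀ {B i i′} → ¬ (i′ * suc B ∈[ i * suc B + 1 , i * suc B + B ])
node∉cell {B} {i} {i′} (start≤x , x≤end) with i′ ≤? i
... | yes i′≤i = contradiction
  (≤-trans (subst (_≤ i′ * suc B) (+-comm (i * suc B) 1) start≤x) (*-monoˡ-≤ (suc B) i′≤i)) 1+n≰n
... | no  i′≰i = contradiction x≤end (<⇒≱ (cell-end<next-cell (≰⇒> i′≰i)))

injective⇒strictlySurjective : ∀ {n} {f : Fin n → Fin n} →
                               Injective _≡_ _≡_ f → StrictlySurjective _≡_ f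
injective⇒strictlySurjective {suc n} {f} f-inj y with Finₚ.any? (λ x → f x Finₚ.≟ y)
... | yes hit = hit
... | no  miss = contradiction (Finₚ.injective⇒≤ {f = avoid} avoid-inj) 1+n≰n
  where
  missed : ∀ x → y ≢ f x
  missed x y≡fx = miss (x , sym y≡fx)
  avoid : Fin (suc n) → Fin n
  avoid x = Fin.punchOut (missed x)
  avoid-inj : Injective _≡_ _≡_ avoid
  avoid-inj {x} {x′} eq = f-inj (Finₚ.punchOut-injective (missed x) (missed x′) eq)

injective⇒↔ : ∀ {a n} {A : Set a} → A ↔ Fin n →
              (f : Fin n → A) → Injective _≡_ _≡_ f → Fin n ↔ A
injective⇒↔ {n = n} {A = A} e f f-inj = mk↔ₛ′ f from f∘from from∘f
  where
  open Inverse e using (strictlyInverseʳ) renaming (to to ⌜_⌝; from to ⌞_⌟)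
  ⌜f⌝-inj : Injective _≡_ _≡_ (⌜_⌝ ∘ f)
  ⌜f⌝-inj {x} {y} eq = f-inj (begin
    f x          ≡⟨ strictlyInverseʳ (f x) ⟨
    ⌞ ⌜ f x ⌝ ⌟  ≡⟨ cong ⌞_⌟ eq ⟩
    ⌞ ⌜ f y ⌝ ⌟  ≡⟨ strictlyInverseʳ (f y) ⟩
    f y          ∎)
    where open ≡-Reasoning
  hit : ∀ p → ∃ λ x → ⌜ f x ⌝ ≡ ⌜ p ⌝
  hit p = injective⇒strictlySurjective ⌜f⌝-inj ⌜ p ⌝
  from : A → Fin n
  from p = proj₁ (hit p)
  f∘from : ∀ p → f (from p) ≡ p
  f∘from p = begin
    f (from p)          ≡⟨ strictlyInverseʳ (f (from p)) ⟨
    ⌞ ⌜ f (from p) ⌝ ⌟  ≡⟨ cong ⌞_⌟ (proj₂ (hit p)) ⟩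
    ⌞ ⌜ p ⌝ ⌟           ≡⟨ strictlyInverseʳ p ⟩
    p                   ∎
    where open ≡-Reasoning
  from∘f : ∀ x → from (f x) ≡ x
  from∘f x = f-inj (f∘from (f x))

module FibreRank {n m : ℕ} (G : Fin n → Fin m) where

  EarlierInFibre : Fin n → Fin n → Set
  EarlierInFibre j j′ = j′ Fin.< j × G j ≡ G j′

  earlierInFibre? : ∀ j j′ → Dec (EarlierInFibre j j′)
  earlierInFibre? j j′ = j′ Fin.<? j ×-dec G j Fin.≟ G j′

  rank : Fin n → ℕ
  rank j = ∑[ j′ < n ] 𝟙 (earlierInFibre? j j′)

  rank+1≤ : ∀ j {r} {R : Fin n → Set r} (R? : ∀ j′ → Dec (R j′)) →
            (∀ {j′} → EarlierInFibre j j′ → R j′) → R j → rank j + 1 ≤ ∑[ j′ < n ] 𝟙 (R? j′)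
  rank+1≤ j R? earlier self = begin
    rank j + 1                                               ≡⟨ cong (rank j +_) (sum-𝟙≟ j) ⟨
    rank j + ∑[ j′ < n ] 𝟙 (j′ Fin.≟ j)                      ≡⟨ ∑-distrib-+ (𝟙 ∘ earlierInFibre? j) _ ⟨
    ∑[ j′ < n ] (𝟙 (earlierInFibre? j j′) + 𝟙 (j′ Fin.≟ j))  ≤⟨ sum-mono-≤ {n} below ⟩
    ∑[ j′ < n ] 𝟙 (R? j′)                                    ∎
    where
    open ≤-Reasoning
    below : ∀ j′ → 𝟙 (earlierInFibre? j j′) + 𝟙 (j′ Fin.≟ j) ≤ 𝟙 (R? j′)
    below j′ = 𝟙-+-≤ (earlierInFibre? j j′) (j′ Fin.≟ j) (R? j′) earlier (λ { refl → self })
                     (λ { ((j<j , _) , refl) → Finₚ.<-irrefl refl j<j })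

  rank<fibre : ∀ j → rank j < ∑[ j′ < n ] 𝟙 (G j Fin.≟ G j′)
  rank<fibre j = subst (_≤ ∑[ j′ < n ] 𝟙 (G j Fin.≟ G j′)) (+-comm (rank j) 1)
                       (rank+1≤ j (λ j′ → G j Fin.≟ G j′) proj₂ refl)

  rank-mono : ∀ {j j′} → j Fin.< j′ → G j ≡ G j′ → rank j < rank j′
  rank-mono {j} {j′} j<j′ eq = subst (_≤ rank j′) (+-comm (rank j) 1)
    (rank+1≤ j (earlierInFibre? j′) (λ (j″<j , eq′) → Finₚ.<-trans j″<j j<j′ , trans (sym eq) eq′)
             (j<j′ , sym eq))

  rank-injective : ∀ {j j′} → G j ≡ G j′ → rank j ≡ rank j′ → j ≡ j′
  rank-injective {j} {j′} eq r≡r′ with Finₚ.<-cmp j j′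
  ... | tri≈ _ j≡j′ _ = j≡j′
  ... | tri< j<j′ _ _ = contradiction r≡r′ (<⇒≢ (rank-mono j<j′ eq))
  ... | tri> _ _ j′<j = contradiction (sym r≡r′) (<⇒≢ (rank-mono j′<j (sym eq)))

-- j ↦ (G j , rank of j in its fibre) is an injection into Fin m × Fin c, a set with c * m
-- elements, hence a bijection.
fibres≤⇒partition : ∀ {c m} (G : Fin (c * m) → Fin m) → (∀ i → ∑[ j < c * m ] 𝟙 (i Fin.≟ G j) ≤ c) →
                    Σ ((Fin m × Fin c) ↔ Fin (c * m)) λ σ → ∀ p → G (Inverse.to σ p) ≡ proj₁ p
fibres≤⇒partition {c} {m} G fibre≤c = ↔-sym τ , λ p → cong proj₁ (Inverse.strictlyInverseˡ τ p)
  where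
  open FibreRank G
  position : Fin (c * m) → Fin m × Fin c
  position j = G j , fromℕ< (<-≤-trans (rank<fibre j) (fibre≤c (G j)))
  position-injective : Injective _≡_ _≡_ position
  position-injective eq = rank-injective (cong proj₁ eq)
    (trans (sym (Finₚ.toℕ-fromℕ< _)) (trans (cong (toℕ ∘ proj₂) eq) (Finₚ.toℕ-fromℕ< _)))
  τ : Fin (c * m) ↔ (Fin m × Fin c)
  τ = injective⇒↔ (↔-trans (×-comm (Fin m) (Fin c)) (↔-sym Finₚ.*↔×)) position position-injective

fibre-sum : ∀ {c m n} (σ : (Fin m × Fin c) ↔ Fin n) (G : Fin n → Fin m) →
            (∀ p → G (Inverse.to σ p) ≡ proj₁ p) → ∀ (w : Fin n → ℕ) i →
            ∑[ j < n ] (𝟙 (i Fin.≟ G j) * w j) ≡ ∑[ r < c ] w (Inverse.to σ (i , r))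
fibre-sum {c} {m} {n} σ G G∘σ w i = sym (begin
  ∑[ r < c ] w (σ⟨ i , r ⟩)                               ≡⟨ sum-cong-≗ (λ r → sum-δ w σ⟨ i , r ⟩) ⟨
  ∑[ r < c ] ∑[ j < n ] (𝟙 (j Fin.≟ σ⟨ i , r ⟩) * w j)    ≡⟨ ∑-comm {c} {n} (λ r j → hit j r * w j) ⟩
  ∑[ j < n ] ∑[ r < c ] (𝟙 (j Fin.≟ σ⟨ i , r ⟩) * w j)    ≡⟨ sum-cong-≗ (λ j → *-distribʳ-sum (w j) (hit j)) ⟨
  ∑[ j < n ] (∑[ r < c ] hit j r * w j)                    ≡⟨ sum-cong-≗ (λ j → cong (_* w j) (hits j)) ⟩
  ∑[ j < n ] (𝟙 (i Fin.≟ G j) * w j)                       ∎)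
  where
  open ≡-Reasoning
  σ⟨_,_⟩ : Fin m → Fin c → Fin n
  σ⟨ i , r ⟩ = Inverse.to σ (i , r)
  hit : Fin n → Fin c → ℕ
  hit j r = 𝟙 (j Fin.≟ σ⟨ i , r ⟩)
  hits : ∀ j → ∑[ r < c ] hit j r ≡ 𝟙 (i Fin.≟ G j)
  hits j with i Fin.≟ G j
  ... | no  i≢Gj = sum-zero λ r → 𝟙-no (j Fin.≟ σ⟨ i , r ⟩) λ { refl → i≢Gj (sym (G∘σ (i , r))) }
  ... | yes i≡Gj = trans (sum-cong-≗ {c} λ r → 𝟙-cong (j Fin.≟ σ⟨ i , r ⟩) (r Fin.≟ r₀) onto into) (sum-𝟙≟ r₀)
    where
    r₀ : Fin c
    r₀ = proj₂ (Inverse.from σ j)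
    σ∘from : σ⟨ proj₁ (Inverse.from σ j) , r₀ ⟩ ≡ j
    σ∘from = Inverse.strictlyInverseˡ σ j
    onto : ∀ {r} → j ≡ σ⟨ i , r ⟩ → r ≡ r₀
    onto {r} refl = sym (cong proj₂ (Inverse.strictlyInverseʳ σ (i , r)))
    into : ∀ {r} → r ≡ r₀ → j ≡ σ⟨ i , r ⟩
    into refl = trans (sym σ∘from)
      (cong (λ i′ → σ⟨ i′ , r₀ ⟩) (trans (sym (G∘σ _)) (trans (cong G σ∘from) (sym i≡Gj))))

cov : Spatial → Stack → ℕ → ℕ
cov emp         s x = 0
cov (t ↦ u)     s x = 𝟙 (x ∈?[ ⟦ t ⟧ s , ⟦ t ⟧ s ])
cov (array t u) s x = 𝟙 (x ∈?[ ⟦ t ⟧ s , ⟦ u ⟧ s ])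
cov (F ⋆ G)     s x = cov F s x + cov G s x

occupied : Maybe ℕ → ℕ
occupied (just _) = 1
occupied nothing  = 0

⊨ˢ⇒cov≡occupied : ∀ {s h} F → s , h ⊨ˢ F → ∀ x → cov F s x ≡ occupied (at h x)
⊨ˢ⇒cov≡occupied emp ⊨emp x = sym (cong occupied (⊨emp x))
⊨ˢ⇒cov≡occupied {s} (t ↦ u) ⊨↦ x with x ≟ ⟦ t ⟧ s
... | yes refl = trans (𝟙-yes (x ∈?[ x , x ]) (≤-refl , ≤-refl)) (sym (cong occupied (proj₁ (⊨↦ x) refl)))
... | no  x≢t  = trans (𝟙-no (x ∈?[ _ , _ ]) (λ (t≤x , x≤t) → x≢t (≤-antisym x≤t t≤x)))
                       (sym (cong occupied (proj₂ (⊨↦ x) x≢t)))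
⊨ˢ⇒cov≡occupied {s} {h} (array t u) (_ , dom≡) x with at h x in hx
... | just _  = 𝟙-yes (x ∈?[ _ , _ ]) (proj₁ (dom≡ x) (subst (_≢ nothing) (sym hx) λ ()))
... | nothing = 𝟙-no (x ∈?[ _ , _ ]) (λ inside → proj₂ (dom≡ x) inside hx)
⊨ˢ⇒cov≡occupied {h = h} (F ⋆ G) (h₁ , h₂ , split , ⊨F , ⊨G) x with split x
... | inj₁ (h₁x≡nothing , hx≡h₂x) =
  cong₂ _+_ (trans (⊨ˢ⇒cov≡occupied F ⊨F x) (cong occupied h₁x≡nothing))
            (trans (⊨ˢ⇒cov≡occupied G ⊨G x) (cong occupied (sym hx≡h₂x)))
... | inj₂ (h₂x≡nothing , hx≡h₁x) =
  trans (cong₂ _+_ (trans (⊨ˢ⇒cov≡occupied F ⊨F x) (cong occupied (sym hx≡h₁x)))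
                   (trans (⊨ˢ⇒cov≡occupied G ⊨G x) (cong occupied h₂x≡nothing)))
        (+-identityʳ (occupied (at h x)))

occupied≤1 : ∀ v → occupied v ≤ 1
occupied≤1 (just _) = ≤-refl
occupied≤1 nothing  = z≤n

⊨ˢ⇒cov≤1 : ∀ {s h} F → s , h ⊨ˢ F → ∀ x → cov F s x ≤ 1
⊨ˢ⇒cov≤1 {h = h} F ⊨F x = subst (_≤ 1) (sym (⊨ˢ⇒cov≡occupied F ⊨F x)) (occupied≤1 (at h x))

ArraysWellFormed : Spatial → Stack → Set
ArraysWellFormed emp         s = ⊤
ArraysWellFormed (t ↦ u)     s = ⊥
ArraysWellFormed (array t u) s = ⟦ t ⟧ s ≤ ⟦ u ⟧ s
ArraysWellFormed (F ⋆ G)     s = ArraysWellFormed F s × ArraysWellFormed G s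

extent : Spatial → Stack → ℕ
extent emp         s = 0
extent (t ↦ u)     s = suc (⟦ t ⟧ s)
extent (array t u) s = suc (⟦ u ⟧ s)
extent (F ⋆ G)     s = extent F s ⊔ extent G s

cov-beyond-extent : ∀ F s x → extent F s ≤ x → cov F s x ≡ 0
cov-beyond-extent emp         s x _ = refl
cov-beyond-extent (t ↦ u)     s x t<x = 𝟙-no (x ∈?[ ⟦ t ⟧ s , ⟦ t ⟧ s ]) (λ (_ , x≤t) → <⇒≱ t<x x≤t)
cov-beyond-extent (array t u) s x u<x = 𝟙-no (x ∈?[ ⟦ t ⟧ s , ⟦ u ⟧ s ]) (λ (_ , x≤u) → <⇒≱ u<x x≤u)
cov-beyond-extent (F ⋆ G)     s x beyond =
  cong₂ _+_ (cov-beyond-extent F s x (m⊔n≤o⇒m≤o _ _ beyond)) (cov-beyond-extent G s x (m⊔n≤o⇒n≤o _ _ beyond))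

fill : ℕ → Maybe ℕ
fill zero    = nothing
fill (suc _) = just 0

fill-+ : ∀ a b → a + b ≤ 1 →
         (fill a ≡ nothing × fill (a + b) ≡ fill b) ⊎ (fill b ≡ nothing × fill (a + b) ≡ fill a)
fill-+ zero    b       _ = inj₁ (refl , refl)
fill-+ (suc a) zero    _ = inj₂ (refl , cong fill (+-identityʳ (suc a)))
fill-+ (suc a) (suc b) a+b≤1 = contradiction a+b≤1 (<⇒≱ (+-mono-≤ z<s z<s))

fill-pos : ∀ c → fill c ≢ nothing → 0 < c
fill-pos zero    c≠0 = contradiction refl c≠0
fill-pos (suc _) _   = z<s

-- Array atoms do not constrain contents, so every covered address is filled with 0.
canonicalHeap : Spatial → Stack → Heap
canonicalHeap F s = record
  { at     = fill ∘ cov F s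
  ; finite = extent F s , λ x beyond → cong fill (cov-beyond-extent F s x beyond)
  }

cov≤1⇒⊨ˢ : ∀ {s} F → ArraysWellFormed F s → (∀ x → cov F s x ≤ 1) → s , canonicalHeap F s ⊨ˢ F
cov≤1⇒⊨ˢ emp _ _ x = refl
cov≤1⇒⊨ˢ {s} (array t u) t≤u _ = t≤u , λ x → in-dom⇒inside x , inside⇒in-dom x
  where
  in-dom⇒inside : ∀ x → fill (𝟙 (x ∈?[ ⟦ t ⟧ s , ⟦ u ⟧ s ])) ≢ nothing → x ∈[ ⟦ t ⟧ s , ⟦ u ⟧ s ]
  in-dom⇒inside x x∈dom = 𝟙-pos (x ∈?[ ⟦ t ⟧ s , ⟦ u ⟧ s ]) (fill-pos _ x∈dom)
  inside⇒in-dom : ∀ x → x ∈[ ⟦ t ⟧ s , ⟦ u ⟧ s ] → fill (𝟙 (x ∈?[ ⟦ t ⟧ s , ⟦ u ⟧ s ])) ≢ nothing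
  inside⇒in-dom x inside rewrite 𝟙-yes (x ∈?[ ⟦ t ⟧ s , ⟦ u ⟧ s ]) inside = λ ()
cov≤1⇒⊨ˢ {s} (F ⋆ G) (wfF , wfG) cov≤1 =
  canonicalHeap F s , canonicalHeap G s , (λ x → fill-+ (cov F s x) (cov G s x) (cov≤1 x)) ,
  cov≤1⇒⊨ˢ F wfF (λ x → ≤-trans (m≤m+n _ _) (cov≤1 x)) ,
  cov≤1⇒⊨ˢ G wfG (λ x → ≤-trans (m≤n+m _ _) (cov≤1 x))

⊨ᵖ-++⁺ : ∀ {s} xs {ys} → s ⊨ᵖ xs → s ⊨ᵖ ys → s ⊨ᵖ (xs ++ ys)
⊨ᵖ-++⁺ []       _          ⊨ys = ⊨ys
⊨ᵖ-++⁺ (_ ∷ xs) (⊨x , ⊨xs) ⊨ys = ⊨x , ⊨ᵖ-++⁺ xs ⊨xs ⊨ys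

⊨ᵖ-++⁻ : ∀ {s} xs {ys} → s ⊨ᵖ (xs ++ ys) → s ⊨ᵖ xs × s ⊨ᵖ ys
⊨ᵖ-++⁻ []       ⊨ys          = tt , ⊨ys
⊨ᵖ-++⁻ (_ ∷ xs) (⊨x , ⊨rest) = let ⊨xs , ⊨ys = ⊨ᵖ-++⁻ xs ⊨rest in (⊨x , ⊨xs) , ⊨ys

⊨ᵖ-tabulate⁺ : ∀ {s n} {f : Fin n → PureAtom} → (∀ i → s ⊨ᵃ f i) → s ⊨ᵖ tabulate f
⊨ᵖ-tabulate⁺ {n = zero}  _   = tt
⊨ᵖ-tabulate⁺ {n = suc n} ⊨fi = ⊨fi zero , ⊨ᵖ-tabulate⁺ (⊨fi ∘ suc)

⊨ᵖ-tabulate⁻ : ∀ {s n} {f : Fin n → PureAtom} → s ⊨ᵖ tabulate f → ∀ i → s ⊨ᵃ f i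
⊨ᵖ-tabulate⁻ (⊨f0 , _)    zero    = ⊨f0
⊨ᵖ-tabulate⁻ (_   , ⊨fs) (suc i) = ⊨ᵖ-tabulate⁻ ⊨fs i

cov-⋆-big : ∀ {n} (F : Fin n → Spatial) s x → cov (⋆-big (tabulate F)) s x ≡ ∑[ i < n ] cov (F i) s x
cov-⋆-big {zero}  F s x = refl
cov-⋆-big {suc n} F s x = cong (cov (F zero) s x +_) (cov-⋆-big (F ∘ suc) s x)

⋆-big-wellFormed : ∀ {n s} (F : Fin n → Spatial) → (∀ i → ArraysWellFormed (F i) s) →
                   ArraysWellFormed (⋆-big (tabulate F)) s
⋆-big-wellFormed {zero}  F _  = tt
⋆-big-wellFormed {suc n} F wf = wf zero , ⋆-big-wellFormed (F ∘ suc) (wf ∘ suc)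

cov-A : ∀ {B m k} s x → cov (SymHeap.spatial A[ B , m , k ]) s x ≡
        ∑[ i < suc m ] 𝟙 (x ∈?[ s (dv (toℕ i)) + 0 , s (dv (toℕ i)) + 0 ]) +
        ∑[ j < 3 * m ] 𝟙 (x ∈?[ s (av (toℕ j)) + 1 , s (av (toℕ j)) + k j ])
cov-A {B} {m} {k} s x = cong₂ _+_ (cov-⋆-big {suc m} (λ i → arrayBO (d (toℕ i)) 0 0) s x)
                                  (cov-⋆-big {3 * m} (λ j → arrayBO (a (toℕ j)) 1 (k j)) s x)

module _ {B m : ℕ} {k : Fin (3 * m) → ℕ} {s : Stack} where

  ⊨ᵖ-A⁺ : (∀ (i : Fin m) → s (dv (suc (toℕ i))) ≡ s (dv (toℕ i)) + B + 1) →
          (∀ j → s (dv 0) ≤ s (av (toℕ j))) → (∀ j → s (av (toℕ j)) + k j < s (dv m)) →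
          s ⊨ᵖ SymHeap.pure A[ B , m , k ]
  ⊨ᵖ-A⁺ nodes starts ends =
    ⊨ᵖ-++⁺ (tabulate {n = m} λ i → d (suc (toℕ i)) =ₜ (d (toℕ i) ⊕ num B ⊕ num 1)) (⊨ᵖ-tabulate⁺ nodes)
      (⊨ᵖ-++⁺ (tabulate {n = 3 * m} λ j → d 0 ≤ₜ a (toℕ j)) (⊨ᵖ-tabulate⁺ starts) (⊨ᵖ-tabulate⁺ ends))

  ⊨ᵖ-A⁻ : s ⊨ᵖ SymHeap.pure A[ B , m , k ] →
          (∀ (i : Fin m) → s (dv (suc (toℕ i))) ≡ s (dv (toℕ i)) + B + 1) ×
          (∀ j → s (dv 0) ≤ s (av (toℕ j))) × (∀ j → s (av (toℕ j)) + k j < s (dv m))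
  ⊨ᵖ-A⁻ ⊨Π =
    let ⊨nodes , ⊨items = ⊨ᵖ-++⁻ (tabulate {n = m} λ i → d (suc (toℕ i)) =ₜ (d (toℕ i) ⊕ num B ⊕ num 1)) ⊨Π
        ⊨starts , ⊨ends = ⊨ᵖ-++⁻ (tabulate {n = 3 * m} λ j → d 0 ≤ₜ a (toℕ j)) ⊨items
    in ⊨ᵖ-tabulate⁻ ⊨nodes , ⊨ᵖ-tabulate⁻ ⊨starts , ⊨ᵖ-tabulate⁻ ⊨ends

*suc≤4*⇒≤3 : ∀ {B c} → c * suc B ≤ 4 * B → c ≤ 3
*suc≤4*⇒≤3 {B} {c} bound with c ≤? 3
... | yes c≤3 = c≤3
... | no  c≰3 = contradiction (begin-strict
  4 * B      <⟨ *-monoʳ-< 4 (n<1+n B) ⟩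
  4 * suc B  ≤⟨ *-monoˡ-≤ (suc B) (≰⇒> c≰3) ⟩
  c * suc B  ≤⟨ bound ⟩
  4 * B      ∎) (<-irrefl refl)
  where open ≤-Reasoning

module IntervalsInCells {B m : ℕ} {k : Fin (3 * m) → ℕ} (inst : Is3PartitionInstance B m k)
                        {D : ℕ} {a : Fin (3 * m) → ℕ}
                        (after-start : ∀ j → D ≤ a j)
                        (before-end : ∀ j → a j + k j < D + m * suc B)
                        (avoids-nodes : ∀ j i → i ≤ m → ¬ (D + i * suc B ∈[ a j + 1 , a j + k j ]))
                        (disjoint : ∀ x → ∑[ j < 3 * m ] 𝟙 (x ∈?[ a j + 1 , a j + k j ]) ≤ 1)
                        where

  placement : ∀ j → ∃ λ (q : Fin m) → D + toℕ q * suc B ≤ a j × a j + k j < D + suc (toℕ q) * suc B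
  placement j = interval-in-cell (after-start j) (before-end j) (avoids-nodes j)

  cell : Fin (3 * m) → Fin m
  cell j = proj₁ (placement j)

  window : Fin m → ℕ
  window q = D + toℕ q * suc B + 1

  inside-window : ∀ j → window (cell j) ≤ a j + 1 × a j + k j < window (cell j) + B
  inside-window j = +-monoˡ-≤ 1 (proj₁ (proj₂ (placement j))) ,
                    subst (a j + k j <_) (next≡ D (toℕ (cell j)) B) (proj₂ (proj₂ (placement j)))
    where
    next≡ : ∀ D q B → D + suc q * suc B ≡ D + q * suc B + 1 + B
    next≡ = solve-∀

  load : Fin m → ℕ
  load i = ∑[ j < 3 * m ] (𝟙 (i Fin.≟ cell j) * k j)

  load≤B : ∀ i → load i ≤ B
  load≤B i = packing a k (λ j → i Fin.≟ cell j) disjoint λ j i≡cell →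
    subst (λ q → window q ≤ a j + 1 × a j + k j < window q + B) (sym i≡cell) (inside-window j)

  load-total : ∑[ i < m ] load i ≡ m * B
  load-total = begin
    ∑[ i < m ] ∑[ j < 3 * m ] (𝟙 (i Fin.≟ cell j) * k j)  ≡⟨ ∑-comm {m} {3 * m} (λ i j → 𝟙 (i Fin.≟ cell j) * k j) ⟩
    ∑[ j < 3 * m ] ∑[ i < m ] (𝟙 (i Fin.≟ cell j) * k j)  ≡⟨ sum-cong-≗ (λ j → sum-δ (λ _ → k j) (cell j)) ⟩
    ∑[ j < 3 * m ] k j                                     ≡⟨ sumFin≗sum k ⟨
    sumFin k                                               ≡⟨ proj₁ inst ⟩
    m * B                                                  ∎
    where open ≡-Reasoning

  load≡B : ∀ i → load i ≡ B
  load≡B = sum-≤-const⇒≡ load≤B load-total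

  -- Every item weighs more than B/4, while a cell carries a load of at most B.
  fibre≤3 : ∀ i → ∑[ j < 3 * m ] 𝟙 (i Fin.≟ cell j) ≤ 3
  fibre≤3 i = *suc≤4*⇒≤3 (begin
    ∑[ j < 3 * m ] 𝟙 (i Fin.≟ cell j) * suc B       ≡⟨ *-distribʳ-sum (suc B) (λ j → 𝟙 (i Fin.≟ cell j)) ⟩
    ∑[ j < 3 * m ] (𝟙 (i Fin.≟ cell j) * suc B)     ≤⟨ sum-mono-≤ {3 * m} item ⟩
    ∑[ j < 3 * m ] (4 * (𝟙 (i Fin.≟ cell j) * k j)) ≡⟨ *-distribˡ-sum 4 (λ j → 𝟙 (i Fin.≟ cell j) * k j) ⟨
    4 * load i                                       ≤⟨ *-monoʳ-≤ 4 (load≤B i) ⟩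
    4 * B                                            ∎)
    where
    open ≤-Reasoning
    item : ∀ j → 𝟙 (i Fin.≟ cell j) * suc B ≤ 4 * (𝟙 (i Fin.≟ cell j) * k j)
    item j with i Fin.≟ cell j
    ... | yes _ = subst₂ _≤_ (sym (+-identityʳ (suc B))) (cong (4 *_) (sym (+-identityʳ (k j))))
                             (proj₁ (proj₂ inst j))
    ... | no  _ = z≤n

  complete3Partition : Complete3Partition B m k
  complete3Partition = σ , λ i → begin
    sumFin (λ r → k (Inverse.to σ (i , r)))   ≡⟨ sumFin≗sum (λ r → k (Inverse.to σ (i , r))) ⟩
    ∑[ r < 3 ] k (Inverse.to σ (i , r))       ≡⟨ fibre-sum σ cell cell∘σ k i ⟨
    load i                                    ≡⟨ load≡B i ⟩
    B                                         ∎
    where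
    open ≡-Reasoning
    σ : (Fin m × Fin 3) ↔ Fin (3 * m)
    σ = proj₁ (fibres≤⇒partition cell fibre≤3)
    cell∘σ : ∀ p → cell (Inverse.to σ p) ≡ proj₁ p
    cell∘σ = proj₂ (fibres≤⇒partition cell fibre≤3)

module ModelToPartition {B m : ℕ} {k : Fin (3 * m) → ℕ} (inst : Is3PartitionInstance B m k)
                        {s : Stack} {h : Heap} (sat : s , h ⊨ A[ B , m , k ]) where

  node : ℕ → ℕ
  node i = s (dv i)

  item : Fin (3 * m) → ℕ
  item j = s (av (toℕ j))

  node-step : ∀ (i : Fin m) → node (suc (toℕ i)) ≡ node (toℕ i) + B + 1
  node-step = proj₁ (⊨ᵖ-A⁻ {B} {m} {k} (proj₁ sat))

  item-after-start : ∀ j → node 0 ≤ item j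
  item-after-start = proj₁ (proj₂ (⊨ᵖ-A⁻ {B} {m} {k} (proj₁ sat)))

  item-before-last : ∀ j → item j + k j < node m
  item-before-last = proj₂ (proj₂ (⊨ᵖ-A⁻ {B} {m} {k} (proj₁ sat)))

  node≡ : ∀ i → i ≤ m → node i ≡ node 0 + i * suc B
  node≡ zero    _   = sym (+-identityʳ (node 0))
  node≡ (suc i) i<m = begin
    node (suc i)                ≡⟨ subst (λ t → node (suc t) ≡ node t + B + 1) (Finₚ.toℕ-fromℕ< i<m)
                                         (node-step (fromℕ< i<m)) ⟩
    node i + B + 1              ≡⟨ cong (λ n → n + B + 1) (node≡ i (<⇒≤ i<m)) ⟩
    node 0 + i * suc B + B + 1  ≡⟨ next-node (node 0) i B ⟩
    node 0 + suc i * suc B      ∎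
    where
    open ≡-Reasoning
    next-node : ∀ D i B → D + i * suc B + B + 1 ≡ D + suc i * suc B
    next-node = solve-∀

  nodes-and-items≤1 : ∀ x → ∑[ i < suc m ] 𝟙 (x ∈?[ node (toℕ i) + 0 , node (toℕ i) + 0 ]) +
                            ∑[ j < 3 * m ] 𝟙 (x ∈?[ item j + 1 , item j + k j ]) ≤ 1
  nodes-and-items≤1 x = subst (_≤ 1) (cov-A {B} {m} {k} s x)
                              (⊨ˢ⇒cov≤1 {s} {h} (SymHeap.spatial A[ B , m , k ]) (proj₂ sat) x)

  avoids-nodes : ∀ j i → i ≤ m → ¬ (node 0 + i * suc B ∈[ item j + 1 , item j + k j ])
  avoids-nodes j i i≤m x∈item = <⇒≱ (+-mono-≤ on-node in-item) (nodes-and-items≤1 x)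
    where
    x : ℕ
    x = node 0 + i * suc B
    i′ : Fin (suc m)
    i′ = fromℕ< (s≤s i≤m)
    node≡x : node (toℕ i′) + 0 ≡ x
    node≡x = trans (+-identityʳ _) (trans (cong node (Finₚ.toℕ-fromℕ< (s≤s i≤m))) (node≡ i i≤m))
    on-node : 1 ≤ ∑[ i < suc m ] 𝟙 (x ∈?[ node (toℕ i) + 0 , node (toℕ i) + 0 ])
    on-node = subst (_≤ ∑[ i < suc m ] 𝟙 (x ∈?[ node (toℕ i) + 0 , node (toℕ i) + 0 ]))
      (𝟙-yes (x ∈?[ node (toℕ i′) + 0 , node (toℕ i′) + 0 ]) (≤-reflexive node≡x , ≤-reflexive (sym node≡x)))
      (term≤sum (λ i → 𝟙 (x ∈?[ node (toℕ i) + 0 , node (toℕ i) + 0 ])) i′)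
    in-item : 1 ≤ ∑[ j < 3 * m ] 𝟙 (x ∈?[ item j + 1 , item j + k j ])
    in-item = subst (_≤ ∑[ j < 3 * m ] 𝟙 (x ∈?[ item j + 1 , item j + k j ]))
      (𝟙-yes (x ∈?[ item j + 1 , item j + k j ]) x∈item)
      (term≤sum (λ j → 𝟙 (x ∈?[ item j + 1 , item j + k j ])) j)

  open IntervalsInCells inst item-after-start
    (λ j → subst (item j + k j <_) (node≡ m ≤-refl) (item-before-last j))
    avoids-nodes
    (λ x → ≤-trans (m≤n+m _ _) (nodes-and-items≤1 x))
    public using (complete3Partition)

prefixSum : ∀ {c} → (Fin c → ℕ) → Fin c → ℕ
prefixSum w zero    = 0
prefixSum w (suc r) = w zero + prefixSum (w ∘ suc) r

prefixSum+term≤sum : ∀ {c} (w : Fin c → ℕ) r → prefixSum w r + w r ≤ sum w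
prefixSum+term≤sum w zero    = m≤m+n (w zero) _
prefixSum+term≤sum w (suc r) =
  subst (_≤ sum w) (sym (+-assoc (w zero) _ _)) (+-monoʳ-≤ (w zero) (prefixSum+term≤sum (w ∘ suc) r))

prefixSum+term≤prefixSum : ∀ {c} (w : Fin c → ℕ) {r r′} → r Fin.< r′ → prefixSum w r + w r ≤ prefixSum w r′
prefixSum+term≤prefixSum w {zero}  {suc r′} _           = m≤m+n (w zero) _
prefixSum+term≤prefixSum w {suc r} {suc r′} (s≤s r<r′) =
  subst (_≤ prefixSum w (suc r′)) (sym (+-assoc (w zero) _ _))
        (+-monoʳ-≤ (w zero) (prefixSum+term≤prefixSum (w ∘ suc) r<r′))

+≤1-exclusive : ∀ {a b} → a ≤ 1 → b ≤ 1 → (0 < a → 0 < b → ⊥) → a + b ≤ 1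
+≤1-exclusive {zero}  {b}     _   b≤1 _   = b≤1
+≤1-exclusive {suc a} {zero}  a≤1 _   _   = subst (_≤ 1) (sym (+-identityʳ (suc a))) a≤1
+≤1-exclusive {suc a} {suc b} _   _   not = contradiction z<s (not z<s)

module Layout {m c B : ℕ} (w : Fin m → Fin c → ℕ) (fits : ∀ i → ∑[ r < c ] w i r ≤ B) where

  start : Fin m × Fin c → ℕ
  start (i , r) = toℕ i * suc B + prefixSum (w i) r

  size : Fin m × Fin c → ℕ
  size (i , r) = w i r

  _∈slot_ : ℕ → Fin m × Fin c → Set
  x ∈slot p = x ∈[ start p + 1 , start p + size p ]

  slot-end≤cell-end : ∀ p → start p + size p ≤ toℕ (proj₁ p) * suc B + B
  slot-end≤cell-end (i , r) = subst (_≤ toℕ i * suc B + B) (sym (+-assoc (toℕ i * suc B) _ _))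
    (+-monoʳ-≤ (toℕ i * suc B) (≤-trans (prefixSum+term≤sum (w i) r) (fits i)))

  slot⊆cell : ∀ {x} p → x ∈slot p → x ∈[ toℕ (proj₁ p) * suc B + 1 , toℕ (proj₁ p) * suc B + B ]
  slot⊆cell p (lo , hi) = ≤-trans (+-monoˡ-≤ 1 (m≤m+n _ _)) lo , ≤-trans hi (slot-end≤cell-end p)

  slot-end<grid-end : ∀ p → start p + size p < m * suc B
  slot-end<grid-end p = ≤-<-trans (slot-end≤cell-end p) (cell-end<next-cell (Finₚ.toℕ<n (proj₁ p)))

  same-cell : ∀ {x i i′ r r′} → x ∈slot (i , r) → x ∈slot (i′ , r′) → i ≡ i′
  same-cell {i = i} {i′} {r} {r′} x∈p x∈p′ =
    Finₚ.toℕ-injective (cell-unique {B} {toℕ i} {toℕ i′} (slot⊆cell (i , r) x∈p) (slot⊆cell (i′ , r′) x∈p′))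

  slot-end≤later-start : ∀ {i r r′} → r Fin.< r′ → start (i , r) + size (i , r) ≤ start (i , r′)
  slot-end≤later-start {i} {r} {r′} r<r′ = subst (_≤ start (i , r′)) (sym (+-assoc (toℕ i * suc B) _ _))
    (+-monoʳ-≤ (toℕ i * suc B) (prefixSum+term≤prefixSum (w i) r<r′))

  slots-ordered : ∀ {x i r r′} → r Fin.< r′ → x ∈slot (i , r) → ¬ x ∈slot (i , r′)
  slots-ordered {x} {i} {r} {r′} r<r′ (_ , x≤end) (start′<x , _) = contradiction
    (≤-trans x≤end (slot-end≤later-start r<r′))
    (<⇒≱ (subst (_≤ x) (+-comm (start (i , r′)) 1) start′<x))

  slots-disjoint : ∀ {x p p′} → x ∈slot p → x ∈slot p′ → p ≡ p′
  slots-disjoint {x} {i , r} {i′ , r′} x∈p x∈p′ with refl ← same-cell x∈p x∈p′ | Finₚ.<-cmp r r′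
  ... | tri≈ _ r≡r′ _ = cong (i ,_) r≡r′
  ... | tri< r<r′ _ _ = contradiction x∈p′ (slots-ordered r<r′ x∈p)
  ... | tri> _ _ r′<r = contradiction x∈p (slots-ordered r′<r x∈p′)

module PartitionToModel {B m : ℕ} {k : Fin (3 * m) → ℕ} (inst : Is3PartitionInstance B m k)
                        (partition : Complete3Partition B m k) where

  σ : (Fin m × Fin 3) ↔ Fin (3 * m)
  σ = proj₁ partition
  open Inverse σ using (to; from; strictlyInverseˡ)
  open Layout (λ i r → k (to (i , r)))
              (λ i → ≤-reflexive (trans (sym (sumFin≗sum (λ r → k (to (i , r))))) (proj₂ partition i)))

  -- The variables a_x with x ≥ 3m do not occur in A; they are sent to 0.
  stack : Stack
  stack (dv i) = i * suc B
  stack (av x) with x <? 3 * m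
  ... | yes x<3m = start (from (fromℕ< x<3m))
  ... | no  _    = 0

  stack-av : ∀ j → stack (av (toℕ j)) ≡ start (from j)
  stack-av j with toℕ j <? 3 * m
  ... | yes j<3m = cong (start ∘ from) (Finₚ.fromℕ<-toℕ j j<3m)
  ... | no  j≮3m = contradiction (Finₚ.toℕ<n j) j≮3m

  size-from : ∀ j → size (from j) ≡ k j
  size-from j = cong k (strictlyInverseˡ j)

  item-slot : ∀ j {x} → x ∈[ stack (av (toℕ j)) + 1 , stack (av (toℕ j)) + k j ] → x ∈slot from j
  item-slot j = subst₂ (λ a k′ → _ ∈[ a + 1 , a + k′ ]) (stack-av j) (sym (size-from j))

  from-injective : ∀ {j j′} → from j ≡ from j′ → j ≡ j′
  from-injective {j} {j′} eq = trans (sym (strictlyInverseˡ j)) (trans (cong to eq) (strictlyInverseˡ j′))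

  k-pos : ∀ j → 0 < k j
  k-pos j with k j | proj₁ (proj₂ inst j)
  ... | suc _ | _ = z<s

  pure : stack ⊨ᵖ SymHeap.pure A[ B , m , k ]
  pure = ⊨ᵖ-A⁺ {B} {m} {k} (λ i → next-node (toℕ i) B) (λ _ → z≤n) item-end
    where
    next-node : ∀ i B → suc i * suc B ≡ i * suc B + B + 1
    next-node = solve-∀
    item-end : ∀ j → stack (av (toℕ j)) + k j < m * suc B
    item-end j = subst (_< m * suc B) (cong₂ _+_ (sym (stack-av j)) (size-from j))
                       (slot-end<grid-end (from j))

  wellFormed : ArraysWellFormed (SymHeap.spatial A[ B , m , k ]) stack
  wellFormed = ⋆-big-wellFormed {suc m} (λ i → arrayBO (d (toℕ i)) 0 0) (λ _ → ≤-refl) ,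
               ⋆-big-wellFormed (λ j → arrayBO (a (toℕ j)) 1 (k j))
                                (λ j → +-monoʳ-≤ (stack (av (toℕ j))) (k-pos j))

  at-node : ∀ {x} (i : Fin (suc m)) → x ∈[ toℕ i * suc B + 0 , toℕ i * suc B + 0 ] → x ≡ toℕ i * suc B
  at-node i (lo , hi) = trans (≤-antisym hi lo) (+-identityʳ _)

  cov≤1 : ∀ x → cov (SymHeap.spatial A[ B , m , k ]) stack x ≤ 1
  cov≤1 x = subst (_≤ 1) (sym (cov-A {B} {m} {k} stack x)) (+≤1-exclusive nodes≤1 items≤1 not-both)
    where
    node? : ∀ i → Dec (x ∈[ toℕ i * suc B + 0 , toℕ i * suc B + 0 ])
    node? i = x ∈?[ toℕ i * suc B + 0 , toℕ i * suc B + 0 ]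
    item? : ∀ j → Dec (x ∈[ stack (av (toℕ j)) + 1 , stack (av (toℕ j)) + k j ])
    item? j = x ∈?[ stack (av (toℕ j)) + 1 , stack (av (toℕ j)) + k j ]
    nodes≤1 : ∑[ i < suc m ] 𝟙 (node? i) ≤ 1
    nodes≤1 = sum-𝟙≤1 node? λ {i} {i′} x∈i x∈i′ →
      Finₚ.toℕ-injective (*-cancelʳ-≡ _ _ (suc B) (trans (sym (at-node i x∈i)) (at-node i′ x∈i′)))
    items≤1 : ∑[ j < 3 * m ] 𝟙 (item? j) ≤ 1
    items≤1 = sum-𝟙≤1 item? λ {j} {j′} x∈j x∈j′ →
      from-injective (slots-disjoint (item-slot j x∈j) (item-slot j′ x∈j′))
    not-both : 0 < ∑[ i < suc m ] 𝟙 (node? i) → 0 < ∑[ j < 3 * m ] 𝟙 (item? j) → ⊥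
    not-both on-node in-item with i , x∈i ← sum-𝟙-pos node? on-node | j , x∈j ← sum-𝟙-pos item? in-item =
      node∉cell {B} {toℕ (proj₁ (from j))} {toℕ i}
        (subst (_∈[ toℕ (proj₁ (from j)) * suc B + 1 , toℕ (proj₁ (from j)) * suc B + B ]) (at-node i x∈i)
               (slot⊆cell (from j) (item-slot j x∈j)))

  satisfiable : Satisfiable A[ B , m , k ]
  satisfiable = stack , canonicalHeap (SymHeap.spatial A[ B , m , k ]) stack , pure ,
                cov≤1⇒⊨ˢ (SymHeap.spatial A[ B , m , k ]) wellFormed cov≤1

lemma17 : (B m : ℕ) (k : Fin (3 * m) → ℕ) →
          Is3PartitionInstance B m k →
          Satisfiable A[ B , m , k ] ⇔ Complete3Partition B m k
lemma17 B m k inst = mk⇔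
  (λ (s , h , sat) → ModelToPartition.complete3Partition inst {s} {h} sat)
  (PartitionToModel.satisfiable inst)
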